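{- Let $r\geqslant 2$ and let $\mathcal{H}=(V,E)$ be an $r$-regular $r$-uniform hypergraph on $V=\{v_1,\dots,v_n\}$ (every hyperedge has exactly $r$ vertices and every vertex belongs to exactly $r$ hyperedges). Let $\mathcal{A}_{\mathcal{H}}$ be its layered e-adjacency tensor, and let $\Delta=\max_{1\leqslant i\leqslant n}\deg(v_i)$, $\Delta^{\star}=\max_{1\leqslant i\leqslant r-1}|\{e\in E:|e|\leqslant i\}|$. Then $\max(\Delta,\Delta^{\star})=r$ and $r$ is an eigenvalue of $\mathcal{A}_{\mathcal{H}}$; that is, the bound $|\lambda|\leqslant\max(\Delta,\Delta^{\star})$ on eigenvalues of $\mathcal{A}_{\mathcal{H}}$ is attained.
   Context: Here $k_{\max}=\max_{e\in E}|e|=r$. The layered e-adjacency tensor $\mathcal{A}_{\mathcal{H}}=(r_{i_1\dots i_{k_{\max}}})$ of a hypergraph $(V,E)$ is the real tensor of order $k_{\max}$ and dimension $N=n+k_{\max}-1$ (index $n+j$ corresponds to an additional vertex $y_j$, $1\leqslant j\leqslant k_{\max}-1$) defined as follows: for each hyperedge $e=\{v_{i_1},\dots,v_{i_s}\}\in E$ with $s=|e|$, every entry whose index tuple is a permutation of $(i_1,\dots,i_s,n+s,\dots,n+k_{\max}-1)$ equals $\frac{1}{(k_{\max}-1)!}$; all other entries are $0$. For a real tensor $\mathcal{T}=(t_{i_1\dots i_m})$ of order $m$ and dimension $N$, $\lambda\in\mathbb{C}$ is an eigenvalue if there is a nonzero $x\in\mathbb{C}^N$ with $\sum_{i_2,\dots,i_m=1}^{N}t_{i\,i_2\dots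 i_m}x_{i_2}\cdots x_{i_m}=\lambda x_i^{m-1}$ for all $1\leqslant i\leqslant N$. -}

module Defs where

open import Data.Nat as ℕ using (ℕ; zero; suc; _+_; _∸_; _≤_; _⊔_; _!)
open import Data.Nat.Properties using (_!≢0; _≤?_)
open import Data.Fin as Fin using (Fin; toℕ; _↑ˡ_; _↑ʳ_)
open import Data.Fin.Properties using (all?)
open import Data.Fin.Subset using (Subset; _∈_; ∣_∣)
open import Data.Fin.Subset.Properties using (_∈?_)
open import Data.List as List using (List; []; _∷_; _++_; length; filter; map; allFin; foldr; tabulate)
open import Data.List.Relation.Unary.Any using (Any; any?)
open import Data.List.Relation.Unary.All using (All)
open import Data.List.Relation.Unary.Unique.Propositional using (Unique)
open import Data.Integer using (+_)
open import Data.Rational using (ℚ; _/_; 0ℚ; _*_) renaming (_+_ to _+ℚ_)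
open import Data.Product using (Σ; ∃; _×_; _,_)
open import Relation.Nullary using (Dec; yes; no; ¬_)
open import Relation.Binary.PropositionalEquality using (_≡_)
import Data.Nat.Properties as ℕP
open import Data.Fin.Properties as FinP using ()

-- Hypergraphs on the vertex set V = Fin n  (v_{i+1} ↔ i : Fin n)
-- A hypergraph is a finite *set* of hyperedges, each a subset of V;
-- we represent E by a duplicate-free list of subsets.

record Hypergraph (n : ℕ) : Set where
  field
    edges    : List (Subset n)
    distinct : Unique edges
open Hypergraph public

size : ∀ {n} → Subset n → ℕ
size = ∣_∣

deg : ∀ {n} → Hypergraph n → Fin n → ℕ
deg H v = length (filter (λ e → v ∈? e) (edges H))

maxList : List ℕ → ℕ
maxList = foldr _⊔_ 0

kmax : ∀ {n} → Hypergraph n → ℕ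
kmax H = maxList (map size (edges H))

Uniform : ∀ {n} → ℕ → Hypergraph n → Set
Uniform r H = All (λ e → size e ≡ r) (edges H)

Regular : ∀ {n} → ℕ → Hypergraph n → Set
Regular {n} r H = (v : Fin n) → deg H v ≡ r

Δ : ∀ {n} → Hypergraph n → ℕ
Δ {n} H = maxList (map (deg H) (allFin n))

edgesUpTo : ∀ {n} → Hypergraph n → ℕ → ℕ
edgesUpTo H i = length (filter (λ e → size e ≤? i) (edges H))

Δ⋆ : ∀ {n} → Hypergraph n → ℕ
Δ⋆ H = maxList (map (λ (t : Fin (kmax H ∸ 1)) → edgesUpTo H (suc (toℕ t))) (allFin (kmax H ∸ 1)))

-- Tensors of order suc m and dimension N with rational entries:
-- an entry is indexed by a tuple (i₁,…,i_{m+1}) : Fin (suc m) → Fin N.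

Tensor : ℕ → ℕ → Set
Tensor m N = (Fin (suc m) → Fin N) → ℚ

cons : ∀ {m N} → Fin N → (Fin m → Fin N) → Fin (suc m) → Fin N
cons i t Fin.zero    = i
cons i t (Fin.suc k) = t k

sumFin : (N : ℕ) → (Fin N → ℚ) → ℚ
sumFin zero    f = 0ℚ
sumFin (suc N) f = f Fin.zero +ℚ sumFin N (λ j → f (Fin.suc j))

sumTuples : (m N : ℕ) → ((Fin m → Fin N) → ℚ) → ℚ
sumTuples zero    N f = f (λ ())
sumTuples (suc m) N f = sumFin N (λ j → sumTuples m N (λ t → f (cons j t)))

prodFin : (m : ℕ) → (Fin m → ℚ) → ℚ
prodFin zero    f = + 1 / 1
prodFin (suc m) f = f Fin.zero * prodFin m (λ k → f (Fin.suc k))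

_^_ : ℚ → ℕ → ℚ
x ^ zero  = + 1 / 1
x ^ suc k = x * (x ^ k)

IsEigenpair : ∀ {m N} → Tensor m N → ℚ → (Fin N → ℚ) → Set
IsEigenpair {m} {N} T λ' x =
  (∃ λ (j : Fin N) → ¬ (x j ≡ 0ℚ)) ×
  ((i : Fin N) →
     sumTuples m N (λ t → T (cons i t) * prodFin m (λ k → x (t k))) ≡ λ' * (x i ^ m))

IsEigenvalue : ∀ {m N} → Tensor m N → ℚ → Set
IsEigenvalue {m} {N} T λ' = ∃ λ (x : Fin N → ℚ) → IsEigenpair T λ' x

-- Index (0-based) i < n is vertex v_{i+1};
-- index n + t (t : Fin d) is the extra vertex y_{t+1}.

module _ {n : ℕ} (H : Hypergraph n) where

  d : ℕ
  d = kmax H ∸ 1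

  vertsOf : Subset n → List (Fin (n + d))
  vertsOf e = map (_↑ˡ d) (filter (λ v → v ∈? e) (allFin n))

  -- the extra vertices y_s, …, y_{k_max - 1} for s = |e|
  extrasOf : Subset n → List (Fin (n + d))
  extrasOf e = map (n ↑ʳ_) (filter (λ (t : Fin d) → size e ≤? suc (toℕ t)) (allFin d))

  layer : Subset n → List (Fin (n + d))
  layer e = vertsOf e ++ extrasOf e

  tupleList : (Fin (suc d) → Fin (n + d)) → List (Fin (n + d))
  tupleList t = tabulate t

  occ : Fin (n + d) → List (Fin (n + d)) → ℕ
  occ j xs = length (filter (FinP._≟ j) xs)

  -- "is a permutation of": equal multiplicity of every index
  IsPermOf : List (Fin (n + d)) → List (Fin (n + d)) → Set
  IsPermOf xs ys = (j : Fin (n + d)) → occ j xs ≡ occ j ys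

  isPermOf? : (xs ys : List (Fin (n + d))) → Dec (IsPermOf xs ys)
  isPermOf? xs ys = all? (λ j → occ j xs ℕP.≟ occ j ys)

  layeredAdj : Tensor d (n + d)
  layeredAdj t with any? (λ e → isPermOf? (tupleList t) (layer e)) (edges H)
  ... | yes _ = (+ 1 / (d !)) {{d !≢0}}
  ... | no  _ = 0ℚ

{-# OPTIONS --safe #-}
module Submission where

-- Since H is r-uniform with at least one edge, k_max = r: no layer receives extra vertices
-- y_j, and the nonzero entries of the tensor, all equal to 1/(r-1)!, sit exactly at the
-- rearrangements of the vertex lists of the edges.  Take x = 1 on V and x = 0 on the y_j.
-- In the row of a vertex v, the tuples (v, i₂, …, i_r) rearranging the vertex list of an edge
-- e ∋ v number (r-1)! (fix v in front and permute the rest), distinct edges have distinct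
-- vertex lists, and every such tuple has x_{i₂}⋯x_{i_r} = 1; so the row sums to deg(v) = r.
-- No edge contains a y_j, so its row vanishes, as does x_{y_j}^{r-1}.  Finally Δ = r by regularity, and Δ⋆ = 0 since no edge has fewer than r vertices.

open import Defs
open import Data.Nat using (ℕ; _≤_; _⊔_)
open import Data.Integer using (+_)
open import Data.Rational using (_/_)
open import Data.Product using (_×_)
open import Relation.Binary.PropositionalEquality using (_≡_)

open import Algebra.Bundles using (CommutativeMonoid; Ring)
import Algebra.Properties.CommutativeMonoid.Sum
open import Data.Bool using (if_then_else_)
open import Data.Fin as Fin using (Fin; toℕ; _↑ˡ_; _↑ʳ_)
open import Data.Fin.Properties using (_≟_; all?)
import Data.Fin.Properties as FinP
open import Data.Fin.Subset as Subset using (Subset; ∣_∣; inside; outside; _⊆_)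
open import Data.Fin.Subset.Properties using (_∈?_)
import Data.Fin.Subset.Properties as SubsetP
import Data.Integer as ℤ
import Data.Integer.Properties as ℤP
open import Data.List using (List; []; _∷_; _++_; length; filter; map; allFin; tabulate)
import Data.List.Properties as ListP
open import Data.List.Relation.Unary.All using (All; []; _∷_)
import Data.List.Relation.Unary.All as All
import Data.List.Relation.Unary.All.Properties as AllP
open import Data.List.Relation.Unary.AllPairs using (_∷_)
open import Data.List.Relation.Unary.Any using (Any; any?)
import Data.List.Relation.Unary.Any.Properties as AnyP
open import Data.List.Relation.Unary.Unique.Propositional using (Unique)
open import Data.Nat as ℕ using (zero; suc; _+_; _*_; _∸_; _<_; _!; z≤n; s≤s)
import Data.Nat.Coprimality as Coprime
open import Data.Nat.ListAction using () renaming (sum to sumList)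
open import Data.Nat.Properties using (_!≢0)
import Data.Nat.Properties as ℕP
open import Data.Product using (_,_)
open import Data.Rational as ℚ using (ℚ; 0ℚ; 1ℚ; mkℚ)
import Data.Rational.Properties as ℚP
open import Data.Sum using (inj₁; inj₂; [_,_]′)
open import Data.Vec using (_∷_; [])
open import Function using (_∘_; id)
open import Function.Bundles using (_⇔_; mk⇔; Equivalence)
open import Function.Definitions using (Injective)
open import Relation.Binary.PropositionalEquality
  using (_≢_; refl; sym; trans; cong; cong₂; subst; module ≡-Reasoning)
open import Relation.Nullary using (Dec; yes; no; does; ¬_; contradiction)
open import Relation.Unary using (Pred; Decidable)
open import Relation.Unary.Properties using (∁?)

-- Indicators and multiplicities

-- Defined through `does`, so that e.g. 𝟙 (suc x ≟ suc j) reduces to 𝟙 (x ≟ j).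
𝟙 : ∀ {p} {P : Set p} → Dec P → ℕ
𝟙 P? = if does P? then 1 else 0

module _ {p} {P : Set p} where

  𝟙-yes : P → (P? : Dec P) → 𝟙 P? ≡ 1
  𝟙-yes _  (yes _) = refl
  𝟙-yes p? (no ¬p) = contradiction p? ¬p

  𝟙-no : ¬ P → (P? : Dec P) → 𝟙 P? ≡ 0
  𝟙-no ¬p (yes p) = contradiction p ¬p
  𝟙-no _  (no _)  = refl

  𝟙≤1 : (P? : Dec P) → 𝟙 P? ≤ 1
  𝟙≤1 (yes _) = s≤s z≤n
  𝟙≤1 (no _)  = z≤n

𝟙-⇔ : ∀ {p q} {P : Set p} {Q : Set q} → P ⇔ Q → (P? : Dec P) (Q? : Dec Q) → 𝟙 P? ≡ 𝟙 Q?
𝟙-⇔ P⇔Q (yes p) Q? = sym (𝟙-yes (Equivalence.to P⇔Q p) Q?)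
𝟙-⇔ P⇔Q (no ¬p) Q? = sym (𝟙-no (¬p ∘ Equivalence.from P⇔Q) Q?)

𝟙-any?-∷ : ∀ {a p} {A : Set a} {P : Pred A p} (P? : Decidable P) {x xs} → (P x → ¬ Any P xs) →
  𝟙 (any? P? (x ∷ xs)) ≡ 𝟙 (P? x) + 𝟙 (any? P? xs)
𝟙-any?-∷ P? {x} {xs} exclusive with P? x | any? P? xs
... | yes Px | yes Pxs = contradiction Pxs (exclusive Px)
... | yes _  | no _    = refl
... | no _   | yes _   = refl
... | no _   | no _    = refl

𝟙-≡⇒ : ∀ {p q} {P : Set p} {Q : Set q} (P? : Dec P) (Q? : Dec Q) → 𝟙 P? ≡ 𝟙 Q? → P → Q
𝟙-≡⇒ (yes _) (yes q) _ _ = q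
𝟙-≡⇒ (yes _) (no _)  () _
𝟙-≡⇒ (no ¬p) _       _ p = contradiction p ¬p

module _ {a p} {A : Set a} {P : Pred A p} (P? : Decidable P) where

  length-filter-∷ : ∀ x xs → length (filter P? (x ∷ xs)) ≡ 𝟙 (P? x) + length (filter P? xs)
  length-filter-∷ x xs with P? x
  ... | yes _ = refl
  ... | no _  = refl

  length-filter-+-∁ : ∀ xs → length (filter P? xs) + length (filter (∁? P?) xs) ≡ length xs
  length-filter-+-∁ []       = refl
  length-filter-+-∁ (x ∷ xs) with P? x
  ... | yes _ = cong suc (length-filter-+-∁ xs)
  ... | no _  = trans (ℕP.+-suc _ _) (cong suc (length-filter-+-∁ xs))

module _ {M : ℕ} where

  multiplicity : Fin M → List (Fin M) → ℕ
  multiplicity j xs = length (filter (_≟ j) xs)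

  -- At M = n + d H, Defs.IsPermOf and Defs.isPermOf? are definitionally SameMultiset and sameMultiset?.
  SameMultiset : List (Fin M) → List (Fin M) → Set
  SameMultiset xs ys = ∀ j → multiplicity j xs ≡ multiplicity j ys

  sameMultiset? : ∀ xs ys → Dec (SameMultiset xs ys)
  sameMultiset? xs ys = all? (λ j → multiplicity j xs ℕ.≟ multiplicity j ys)

  MultiplicityFree : List (Fin M) → Set
  MultiplicityFree xs = ∀ j → multiplicity j xs ≤ 1

  multiplicity-∷ : ∀ j x xs → multiplicity j (x ∷ xs) ≡ 𝟙 (x ≟ j) + multiplicity j xs
  multiplicity-∷ j = length-filter-∷ (_≟ j)

  multiplicity-∷-≡ : ∀ x xs → multiplicity x (x ∷ xs) ≡ suc (multiplicity x xs)
  multiplicity-∷-≡ x xs = cong length (ListP.filter-accept (_≟ x) refl)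

  multiplicity-∷-≢ : ∀ {x j} xs → x ≢ j → multiplicity j (x ∷ xs) ≡ multiplicity j xs
  multiplicity-∷-≢ {j = j} xs x≢j = cong length (ListP.filter-reject (_≟ j) x≢j)

  0<multiplicity-tabulate : ∀ {m} (t : Fin m → Fin M) k → 0 < multiplicity (t k) (tabulate t)
  0<multiplicity-tabulate t k = ListP.filter-some (_≟ t k) (AnyP.tabulate⁺ k refl)

  module _ {q} {Q : Pred (Fin M) q} (Q? : Decidable Q) where

    multiplicity-filter-∈ : ∀ {j} → Q j → ∀ xs → multiplicity j (filter Q? xs) ≡ multiplicity j xs
    multiplicity-filter-∈ Qj [] = refl
    multiplicity-filter-∈ {j} Qj (x ∷ xs) with Q? x
    ... | yes _  = begin
      multiplicity j (x ∷ filter Q? xs)         ≡⟨ multiplicity-∷ j x _ ⟩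
      𝟙 (x ≟ j) + multiplicity j (filter Q? xs) ≡⟨ cong (𝟙 (x ≟ j) ℕ.+_) (multiplicity-filter-∈ Qj xs) ⟩
      𝟙 (x ≟ j) + multiplicity j xs             ≡⟨ multiplicity-∷ j x xs ⟨
      multiplicity j (x ∷ xs)                   ∎
      where open ≡-Reasoning
    ... | no ¬Qx = trans (multiplicity-filter-∈ Qj xs)
                         (sym (multiplicity-∷-≢ xs (λ x≡j → ¬Qx (subst Q (sym x≡j) Qj))))

    multiplicity-filter-∉ : ∀ {j} → ¬ Q j → ∀ xs → multiplicity j (filter Q? xs) ≡ 0
    multiplicity-filter-∉ ¬Qj xs = cong length (ListP.filter-none (_≟ _)
      (All.map (λ Qx x≡j → ¬Qj (subst Q x≡j Qx)) (AllP.all-filter Q? xs)))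

module _ {K M : ℕ} {f : Fin K → Fin M} where

  multiplicity-map : Injective _≡_ _≡_ f → ∀ a xs → multiplicity (f a) (map f xs) ≡ multiplicity a xs
  multiplicity-map f-inj a [] = refl
  multiplicity-map f-inj a (x ∷ xs) with x ≟ a
  ... | yes refl = trans (multiplicity-∷-≡ (f a) _) (cong suc (multiplicity-map f-inj a xs))
  ... | no x≢a   = trans (multiplicity-∷-≢ _ (x≢a ∘ f-inj)) (multiplicity-map f-inj a xs)

  multiplicity-map-∉ : ∀ {j} → (∀ a → f a ≢ j) → ∀ xs → multiplicity j (map f xs) ≡ 0
  multiplicity-map-∉ {j} f≢j xs = cong length (ListP.filter-none (_≟ j) (AllP.map⁺ (All.universal f≢j xs)))

allFin-suc : ∀ n → allFin (suc n) ≡ Fin.zero ∷ map Fin.suc (allFin n)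
allFin-suc n = cong (Fin.zero ∷_) (sym (ListP.map-tabulate id Fin.suc))

multiplicity-allFin : ∀ {n} (a : Fin n) → multiplicity a (allFin n) ≡ 1
multiplicity-allFin {suc n} a = trans (cong (multiplicity a) (allFin-suc n)) (shifted a)
  where
  shifted : ∀ a → multiplicity a (Fin.zero ∷ map Fin.suc (allFin n)) ≡ 1
  shifted Fin.zero    = cong suc (multiplicity-map-∉ (λ _ ()) (allFin n))
  shifted (Fin.suc b) = trans (multiplicity-map FinP.suc-injective b (allFin n)) (multiplicity-allFin b)

length-filter-∈-map-suc : ∀ {n} b (p : Subset n) xs →
  length (filter (_∈? (b ∷ p)) (map Fin.suc xs)) ≡ length (filter (_∈? p) xs)
length-filter-∈-map-suc b p []       = refl
length-filter-∈-map-suc b p (x ∷ xs) with x ∈? p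
... | yes _ = cong suc (length-filter-∈-map-suc b p xs)
... | no _  = length-filter-∈-map-suc b p xs

length-filter-∈-allFin : ∀ {n} (p : Subset n) → length (filter (_∈? p) (allFin n)) ≡ ∣ p ∣
length-filter-∈-allFin []            = refl
length-filter-∈-allFin (inside ∷ p)  = trans (cong (length ∘ filter (_∈? (inside ∷ p))) (allFin-suc _))
  (cong suc (trans (length-filter-∈-map-suc inside p (allFin _)) (length-filter-∈-allFin p)))
length-filter-∈-allFin (outside ∷ p) = trans (cong (length ∘ filter (_∈? (outside ∷ p))) (allFin-suc _))
  (trans (length-filter-∈-map-suc outside p (allFin _)) (length-filter-∈-allFin p))

-- Sums over index tuples

module TupleSum {c ℓ} (M : CommutativeMonoid c ℓ) where

  open CommutativeMonoid M using (Carrier; _≈_; _∙_; ε) renaming (refl to ≈-refl; trans to ≈-trans)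
  open import Algebra.Properties.CommutativeMonoid.Sum M
    using (sum; sum-cong-≋; sum-replicate-zero; ∑-distrib-+)

  ∑ᵗ : (m N : ℕ) → ((Fin m → Fin N) → Carrier) → Carrier
  ∑ᵗ zero    N f = f (λ ())
  ∑ᵗ (suc m) N f = sum (λ j → ∑ᵗ m N (f ∘ cons j))

  ∑ᵗ-cong : ∀ m N {f g : (Fin m → Fin N) → Carrier} → (∀ t → f t ≈ g t) → ∑ᵗ m N f ≈ ∑ᵗ m N g
  ∑ᵗ-cong zero    N f≈g = f≈g _
  ∑ᵗ-cong (suc m) N f≈g = sum-cong-≋ (λ j → ∑ᵗ-cong m N (f≈g ∘ cons j))

  ∑ᵗ-zero : ∀ m N → ∑ᵗ m N (λ _ → ε) ≈ ε
  ∑ᵗ-zero zero    N = ≈-refl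
  ∑ᵗ-zero (suc m) N = ≈-trans (sum-cong-≋ {N} {y = λ _ → ε} (λ _ → ∑ᵗ-zero m N)) (sum-replicate-zero N)

  ∑ᵗ-distrib-∙ : ∀ m N (f g : (Fin m → Fin N) → Carrier) → ∑ᵗ m N (λ t → f t ∙ g t) ≈ ∑ᵗ m N f ∙ ∑ᵗ m N g
  ∑ᵗ-distrib-∙ zero    N f g = ≈-refl
  ∑ᵗ-distrib-∙ (suc m) N f g =
    ≈-trans (sum-cong-≋ (λ j → ∑ᵗ-distrib-∙ m N (f ∘ cons j) (g ∘ cons j)))
            (∑-distrib-+ (λ j → ∑ᵗ m N (f ∘ cons j)) (λ j → ∑ᵗ m N (g ∘ cons j)))

module ℕΣ = Algebra.Properties.CommutativeMonoid.Sum ℕP.+-0-commutativeMonoid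
module ℕᵗ = TupleSum ℕP.+-0-commutativeMonoid

module TupleSumMultiples {c ℓ} (M : CommutativeMonoid c ℓ) where

  open CommutativeMonoid M using (Carrier; _≈_; _∙_; ∙-congˡ; monoid)
    renaming (refl to ≈-refl; trans to ≈-trans; sym to ≈-sym)
  open import Algebra.Properties.CommutativeMonoid.Sum M using (sum; sum-cong-≋)
  open import Algebra.Properties.Monoid.Mult monoid using (×-homo-+) renaming (_×_ to _·_)
  open TupleSum M

  sum-· : ∀ N (g : Fin N → ℕ) x → sum (λ j → g j · x) ≈ ℕΣ.sum g · x
  sum-· zero    g x = ≈-refl
  sum-· (suc N) g x = ≈-trans (∙-congˡ (sum-· N (g ∘ Fin.suc) x)) (≈-sym (×-homo-+ x (g Fin.zero) _))

  ∑ᵗ-· : ∀ m N (g : (Fin m → Fin N) → ℕ) x → ∑ᵗ m N (λ t → g t · x) ≈ ℕᵗ.∑ᵗ m N g · x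
  ∑ᵗ-· zero    N g x = ≈-refl
  ∑ᵗ-· (suc m) N g x = ≈-trans (sum-cong-≋ (λ j → ∑ᵗ-· m N (g ∘ cons j) x)) (sum-· N _ x)

open ℕᵗ using (∑ᵗ; ∑ᵗ-cong; ∑ᵗ-zero; ∑ᵗ-distrib-∙)
open ℕΣ using (sum; sum-cong-≗; ∑-distrib-+; sum-replicate-zero)
open import Algebra.Properties.Semiring.Sum ℕP.+-*-semiring using (*-distribʳ-sum)

-- Counting the rearrangements of a list

sum-𝟙-≟ : ∀ {M} (x : Fin M) → sum (λ j → 𝟙 (x ≟ j)) ≡ 1
sum-𝟙-≟ {suc M} Fin.zero    = cong suc (sum-replicate-zero M)
sum-𝟙-≟ {suc M} (Fin.suc x) = sum-𝟙-≟ x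

sum-multiplicity : ∀ {M} (xs : List (Fin M)) → sum (λ j → multiplicity j xs) ≡ length xs
sum-multiplicity {M} []       = sum-replicate-zero M
sum-multiplicity     (x ∷ xs) = begin
  sum (λ j → multiplicity j (x ∷ xs))                     ≡⟨ sum-cong-≗ (λ j → multiplicity-∷ j x xs) ⟩
  sum (λ j → 𝟙 (x ≟ j) + multiplicity j xs)               ≡⟨ ∑-distrib-+ (λ j → 𝟙 (x ≟ j)) _ ⟩
  sum (λ j → 𝟙 (x ≟ j)) + sum (λ j → multiplicity j xs)   ≡⟨ cong₂ _+_ (sum-𝟙-≟ x) (sum-multiplicity xs) ⟩
  suc (length xs)                                         ∎
  where open ≡-Reasoning

module _ {M : ℕ} where

  remove : Fin M → List (Fin M) → List (Fin M)
  remove a = filter (∁? (_≟ a))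

  multiplicity-remove-≡ : ∀ a xs → multiplicity a (remove a xs) ≡ 0
  multiplicity-remove-≡ a = multiplicity-filter-∉ (∁? (_≟ a)) (λ a≢a → a≢a refl)

  multiplicity-remove-≢ : ∀ {a j} → j ≢ a → ∀ xs → multiplicity j (remove a xs) ≡ multiplicity j xs
  multiplicity-remove-≢ {a} = multiplicity-filter-∈ (∁? (_≟ a))

  multiplicity-+-length-remove : ∀ a xs → multiplicity a xs + length (remove a xs) ≡ length xs
  multiplicity-+-length-remove a = length-filter-+-∁ (_≟ a)

  remove-multiplicityFree : ∀ a {xs} → MultiplicityFree xs → MultiplicityFree (remove a xs)
  remove-multiplicityFree a {xs} free j with j ≟ a
  ... | yes refl = subst (_≤ 1) (sym (multiplicity-remove-≡ a xs)) z≤n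
  ... | no j≢a   = subst (_≤ 1) (sym (multiplicity-remove-≢ j≢a xs)) (free j)

  sameMultiset-∷⇔remove : ∀ {a : Fin M} {xs ys} → multiplicity a ys ≡ 1 →
    SameMultiset (a ∷ xs) ys ⇔ SameMultiset xs (remove a ys)
  sameMultiset-∷⇔remove {a} {xs} {ys} once = mk⇔ to from
    where
    to : SameMultiset (a ∷ xs) ys → SameMultiset xs (remove a ys)
    to same j with j ≟ a
    ... | yes refl = trans (ℕP.suc-injective (trans (sym (multiplicity-∷-≡ a xs)) (trans (same a) once)))
                           (sym (multiplicity-remove-≡ a ys))
    ... | no j≢a   = trans (sym (multiplicity-∷-≢ xs (j≢a ∘ sym)))
                           (trans (same j) (sym (multiplicity-remove-≢ j≢a ys)))
    from : SameMultiset xs (remove a ys) → SameMultiset (a ∷ xs) ys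
    from same j with j ≟ a
    ... | yes refl = trans (multiplicity-∷-≡ a xs)
                           (trans (cong suc (trans (same a) (multiplicity-remove-≡ a ys))) (sym once))
    ... | no j≢a   = trans (multiplicity-∷-≢ xs (j≢a ∘ sym))
                           (trans (same j) (multiplicity-remove-≢ j≢a ys))

  ¬sameMultiset-∷ : ∀ {a : Fin M} {xs ys} → multiplicity a ys ≡ 0 → ¬ SameMultiset (a ∷ xs) ys
  ¬sameMultiset-∷ {a} {xs} {ys} absent same with trans (sym (multiplicity-∷-≡ a xs)) (trans (same a) absent)
  ... | ()

  -- Fixing the first entry a, the tuples rearranging ys are those whose tail rearranges ys minus one a.
  mutual
    ∑ᵗ-arrangements : ∀ m ys → MultiplicityFree ys → length ys ≡ m →
      ∑ᵗ m M (λ t → 𝟙 (sameMultiset? (tabulate t) ys)) ≡ m !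
    ∑ᵗ-arrangements zero    []       _    _   = 𝟙-yes (λ _ → refl) (sameMultiset? {M} [] [])
    ∑ᵗ-arrangements (suc m) ys       free len = begin
      sum (λ a → ∑ᵗ m M (λ t → 𝟙 (sameMultiset? (a ∷ tabulate t) ys)))
        ≡⟨ sum-cong-≗ (λ a → ∑ᵗ-arrangements-∷ m a ys free len) ⟩
      sum (λ a → multiplicity a ys * m !)   ≡⟨ *-distribʳ-sum (m !) (λ a → multiplicity a ys) ⟨
      sum (λ a → multiplicity a ys) * m !   ≡⟨ cong (_* m !) (trans (sum-multiplicity ys) len) ⟩
      suc m * m !                           ∎
      where open ≡-Reasoning

    ∑ᵗ-arrangements-∷ : ∀ m a ys → MultiplicityFree ys → length ys ≡ suc m →
      ∑ᵗ m M (λ t → 𝟙 (sameMultiset? (a ∷ tabulate t) ys)) ≡ multiplicity a ys * m !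
    ∑ᵗ-arrangements-∷ m a ys free len with multiplicity a ys in eq | free a
    ... | 0 | _ = trans
      (∑ᵗ-cong m M (λ t → 𝟙-no (¬sameMultiset-∷ {a} {tabulate t} {ys} eq)
                              (sameMultiset? (a ∷ tabulate t) ys)))
      (∑ᵗ-zero m M)
    ... | 1 | _ = begin
      ∑ᵗ m M (λ t → 𝟙 (sameMultiset? (a ∷ tabulate t) ys))
        ≡⟨ ∑ᵗ-cong m M (λ t → 𝟙-⇔ (sameMultiset-∷⇔remove {a} {tabulate t} {ys} eq)
                                   (sameMultiset? (a ∷ tabulate t) ys)
                                   (sameMultiset? (tabulate t) (remove a ys))) ⟩
      ∑ᵗ m M (λ t → 𝟙 (sameMultiset? (tabulate t) (remove a ys)))
        ≡⟨ ∑ᵗ-arrangements m (remove a ys) (remove-multiplicityFree a {ys} free) length-remove ⟩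
      m !     ≡⟨ ℕP.+-identityʳ (m !) ⟨
      1 * m ! ∎
      where
      open ≡-Reasoning
      length-remove : length (remove a ys) ≡ m
      length-remove = ℕP.suc-injective (begin
        1 + length (remove a ys)                    ≡⟨ cong (ℕ._+ length (remove a ys)) eq ⟨
        multiplicity a ys + length (remove a ys)    ≡⟨ multiplicity-+-length-remove a ys ⟩
        length ys                                   ≡⟨ len ⟩
        suc m                                       ∎)
    ... | suc (suc _) | s≤s ()

-- Rational sums and multiples

module ℚΣ = Algebra.Properties.CommutativeMonoid.Sum ℚP.+-0-commutativeMonoid
module ℚᵗ = TupleSum ℚP.+-0-commutativeMonoid
open TupleSumMultiples ℚP.+-0-commutativeMonoid using (∑ᵗ-·)
open import Algebra.Properties.Semiring.Mult (Ring.semiring ℚP.+-*-ring)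
  using (×-assocˡ; ×-assoc-*) renaming (_×_ to _·_)

sumFin≡sum : ∀ N (f : Fin N → ℚ) → sumFin N f ≡ ℚΣ.sum f
sumFin≡sum zero    f = refl
sumFin≡sum (suc N) f = cong (f Fin.zero ℚ.+_) (sumFin≡sum N (f ∘ Fin.suc))

sumTuples≡∑ᵗ : ∀ m N (f : (Fin m → Fin N) → ℚ) → sumTuples m N f ≡ ℚᵗ.∑ᵗ m N f
sumTuples≡∑ᵗ zero    N f = refl
sumTuples≡∑ᵗ (suc m) N f =
  trans (sumFin≡sum N _) (ℚΣ.sum-cong-≗ (λ j → sumTuples≡∑ᵗ m N (f ∘ cons j)))

prodFin-1ℚ : ∀ m (f : Fin m → ℚ) → (∀ k → f k ≡ 1ℚ) → prodFin m f ≡ 1ℚ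
prodFin-1ℚ zero    f f≡1 = refl
prodFin-1ℚ (suc m) f f≡1 = cong₂ ℚ._*_ (f≡1 Fin.zero) (prodFin-1ℚ m (f ∘ Fin.suc) (f≡1 ∘ Fin.suc))

1ℚ^n≡1ℚ : ∀ n → 1ℚ ^ n ≡ 1ℚ
1ℚ^n≡1ℚ zero    = refl
1ℚ^n≡1ℚ (suc n) = trans (ℚP.*-identityˡ _) (1ℚ^n≡1ℚ n)

0ℚ^n≡0ℚ : ∀ n .{{_ : ℕ.NonZero n}} → 0ℚ ^ n ≡ 0ℚ
0ℚ^n≡0ℚ (suc n) = ℚP.*-zeroˡ (0ℚ ^ n)

fromℕ : ℕ → ℚ
fromℕ n = mkℚ (+ n) 0 (Coprime.sym (Coprime.1-coprimeTo n))

n/1≡fromℕ : ∀ n → + n / 1 ≡ fromℕ n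
n/1≡fromℕ n = ℚP.normalize-coprime _

·1ℚ≡n/1 : ∀ n → n · 1ℚ ≡ + n / 1
·1ℚ≡n/1 zero    = refl
·1ℚ≡n/1 (suc n) = begin
  1ℚ ℚ.+ n · 1ℚ                    ≡⟨ cong (1ℚ ℚ.+_) (trans (·1ℚ≡n/1 n) (n/1≡fromℕ n)) ⟩
  1ℚ ℚ.+ fromℕ n                   ≡⟨ ℚP./-cong (cong (ℤ._+_ (+ 1)) (ℤP.*-identityʳ (+ n))) refl ⟩
  + suc n / 1                      ∎
  where open ≡-Reasoning

·-inverse : ∀ n .{{_ : ℕ.NonZero n}} → n · (+ 1 / n) ≡ 1ℚ
·-inverse n@(suc _) = begin
  n · (+ 1 / n)              ≡⟨ cong (n ·_) (ℚP.*-identityˡ (+ 1 / n)) ⟨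
  n · (1ℚ ℚ.* (+ 1 / n))     ≡⟨ ×-assoc-* n 1ℚ (+ 1 / n) ⟨
  n · 1ℚ ℚ.* (+ 1 / n)       ≡⟨ cong₂ ℚ._*_ (trans (·1ℚ≡n/1 n) (n/1≡fromℕ n))
                                              (ℚP.normalize-coprime (Coprime.1-coprimeTo n)) ⟩
  fromℕ n ℚ.* ℚ.1/ fromℕ n   ≡⟨ ℚP.*-inverseʳ (fromℕ n) ⟩
  1ℚ                         ∎
  where open ≡-Reasoning

-- Layers of the edges of a uniform hypergraph

module _ {n D : ℕ} where

  fin+-elim : ∀ {ℓ} (P : Fin (n + D) → Set ℓ) → (∀ v → P (v ↑ˡ D)) → (∀ s → P (n ↑ʳ s)) → ∀ j → P j
  fin+-elim P left right j = subst P (FinP.join-splitAt n D j) (by-side (Fin.splitAt n j))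
    where
    by-side : ∀ w → P (Fin.join n D w)
    by-side (inj₁ v) = left v
    by-side (inj₂ s) = right s

  ↑ˡ≢↑ʳ : ∀ (v : Fin n) (s : Fin D) → v ↑ˡ D ≢ n ↑ʳ s
  ↑ˡ≢↑ʳ v s eq
    with trans (sym (FinP.splitAt-↑ˡ n v D)) (trans (cong (Fin.splitAt n) eq) (FinP.splitAt-↑ʳ n D s))
  ... | ()

module UniformLayers {n : ℕ} (H : Hypergraph n) where

  D N : ℕ
  D = d H
  N = n + D

  1/D! : ℚ
  1/D! = (+ 1 / D !) {{D !≢0}}

  members : Subset n → List (Fin n)
  members e = filter (_∈? e) (allFin n)

  module _ {e : Subset n} (size≡ : size e ≡ suc D) where

    extrasOf≡[] : extrasOf H e ≡ []
    extrasOf≡[] = cong (map (n ↑ʳ_)) (ListP.filter-none (λ t → size e ℕP.≤? suc (toℕ t))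
      (AllP.tabulate⁺ (λ t → ℕP.<⇒≱ (subst (suc (toℕ t) <_) (sym size≡) (s≤s (FinP.toℕ<n t))))))

    layer≡vertsOf : layer H e ≡ vertsOf H e
    layer≡vertsOf = trans (cong (vertsOf H e ++_) extrasOf≡[]) (ListP.++-identityʳ _)

    multiplicity-layer-↑ˡ : ∀ v → multiplicity (v ↑ˡ D) (layer H e) ≡ 𝟙 (v ∈? e)
    multiplicity-layer-↑ˡ v = begin
      multiplicity (v ↑ˡ D) (layer H e)   ≡⟨ cong (multiplicity (v ↑ˡ D)) layer≡vertsOf ⟩
      multiplicity (v ↑ˡ D) (vertsOf H e) ≡⟨ multiplicity-map (FinP.↑ˡ-injective D _ _) v (members e) ⟩
      multiplicity v (members e)          ≡⟨ in-filter (v ∈? e) ⟩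
      𝟙 (v ∈? e)                          ∎
      where
      open ≡-Reasoning
      in-filter : (v∈?e : Dec (v Subset.∈ e)) → multiplicity v (members e) ≡ 𝟙 v∈?e
      in-filter (yes v∈e) = trans (multiplicity-filter-∈ (_∈? e) v∈e (allFin n)) (multiplicity-allFin v)
      in-filter (no v∉e)  = multiplicity-filter-∉ (_∈? e) v∉e (allFin n)

    multiplicity-layer-↑ʳ : ∀ s → multiplicity (n ↑ʳ s) (layer H e) ≡ 0
    multiplicity-layer-↑ʳ s = trans (cong (multiplicity (n ↑ʳ s)) layer≡vertsOf)
                                    (multiplicity-map-∉ (λ v → ↑ˡ≢↑ʳ v s) (members e))

    length-layer : length (layer H e) ≡ suc D
    length-layer = begin
      length (layer H e)                           ≡⟨ cong length layer≡vertsOf ⟩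
      length (vertsOf H e)                         ≡⟨ ListP.length-map (_↑ˡ D) (members e) ⟩
      length (members e)                           ≡⟨ length-filter-∈-allFin e ⟩
      size e                                       ≡⟨ size≡ ⟩
      suc D                                        ∎
      where open ≡-Reasoning

    layer-multiplicityFree : MultiplicityFree (layer H e)
    layer-multiplicityFree = fin+-elim (λ j → multiplicity j (layer H e) ≤ 1)
      (λ v → subst (_≤ 1) (sym (multiplicity-layer-↑ˡ v)) (𝟙≤1 (v ∈? e)))
      (λ s → subst (_≤ 1) (sym (multiplicity-layer-↑ʳ s)) z≤n)

  layer-⊆ : ∀ {e e′} → size e ≡ suc D → size e′ ≡ suc D →
    SameMultiset (layer H e) (layer H e′) → e ⊆ e′
  layer-⊆ {e} {e′} size≡ size≡′ same {v} =
    𝟙-≡⇒ (v ∈? e) (v ∈? e′) (begin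
      𝟙 (v ∈? e)                         ≡⟨ multiplicity-layer-↑ˡ size≡ v ⟨
      multiplicity (v ↑ˡ D) (layer H e)  ≡⟨ same (v ↑ˡ D) ⟩
      multiplicity (v ↑ˡ D) (layer H e′) ≡⟨ multiplicity-layer-↑ˡ size≡′ v ⟩
      𝟙 (v ∈? e′)                        ∎)
    where open ≡-Reasoning

  layer-injective : ∀ {e e′} → size e ≡ suc D → size e′ ≡ suc D →
    SameMultiset (layer H e) (layer H e′) → e ≡ e′
  layer-injective size≡ size≡′ same =
    SubsetP.⊆-antisym (layer-⊆ size≡ size≡′ same) (layer-⊆ size≡′ size≡ (sym ∘ same))

  vertexIndicator : Fin N → ℚ
  vertexIndicator j = [ (λ _ → 1ℚ) , (λ _ → 0ℚ) ]′ (Fin.splitAt n j)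

  vertexIndicator-↑ˡ : ∀ v → vertexIndicator (v ↑ˡ D) ≡ 1ℚ
  vertexIndicator-↑ˡ v = cong [ (λ _ → 1ℚ) , (λ _ → 0ℚ) ]′ (FinP.splitAt-↑ˡ n v D)

  vertexIndicator-↑ʳ : ∀ s → vertexIndicator (n ↑ʳ s) ≡ 0ℚ
  vertexIndicator-↑ʳ s = cong [ (λ _ → 1ℚ) , (λ _ → 0ℚ) ]′ (FinP.splitAt-↑ʳ n D s)

  vertexIndicator-layer : ∀ {e} → size e ≡ suc D →
    ∀ j → 0 < multiplicity j (layer H e) → vertexIndicator j ≡ 1ℚ
  vertexIndicator-layer size≡ = fin+-elim _
    (λ v _ → vertexIndicator-↑ˡ v)
    (λ s 0<m → contradiction (subst (0 <_) (multiplicity-layer-↑ʳ size≡ s) 0<m) (λ ()))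

  Arranges : Fin N → (Fin D → Fin N) → Subset n → Set
  Arranges i t e = IsPermOf H (tupleList H (cons i t)) (layer H e)

  arranges? : ∀ i t → Decidable (Arranges i t)
  arranges? i t e = isPermOf? H (tupleList H (cons i t)) (layer H e)

  UniformEdges : List (Subset n) → Set
  UniformEdges = All (λ e → size e ≡ suc D)

  arranges-exclusive : ∀ {i t e es} → size e ≡ suc D → All (e ≢_) es → UniformEdges es →
    Arranges i t e → ¬ Any (Arranges i t) es
  arranges-exclusive size≡ e∉es uniform arr arr-es with All.lookupAny (All.zip (e∉es , uniform)) arr-es
  ... | (e≢e′ , size≡′) , arr′ = e≢e′ (layer-injective size≡ size≡′ (λ j → trans (sym (arr j)) (arr′ j)))

  layerDegree : Fin N → List (Subset n) → ℕ
  layerDegree i es = sumList (map (λ e → multiplicity i (layer H e)) es)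

  ∑ᵗ-arranged-edges : ∀ i es → Unique es → UniformEdges es →
    ∑ᵗ D N (λ t → 𝟙 (any? (arranges? i t) es)) ≡ layerDegree i es * D !
  ∑ᵗ-arranged-edges i []       _                _                = ∑ᵗ-zero D N
  ∑ᵗ-arranged-edges i (e ∷ es) (e∉es ∷ unique) (size≡ ∷ uniform) = begin
    ∑ᵗ D N (λ t → 𝟙 (any? (arranges? i t) (e ∷ es)))
      ≡⟨ ∑ᵗ-cong D N (λ t → 𝟙-any?-∷ (arranges? i t) (arranges-exclusive {i} {t} size≡ e∉es uniform)) ⟩
    ∑ᵗ D N (λ t → 𝟙 (arranges? i t e) + 𝟙 (any? (arranges? i t) es))
      ≡⟨ ∑ᵗ-distrib-∙ D N (λ t → 𝟙 (arranges? i t e)) (λ t → 𝟙 (any? (arranges? i t) es)) ⟩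
    ∑ᵗ D N (λ t → 𝟙 (arranges? i t e)) + ∑ᵗ D N (λ t → 𝟙 (any? (arranges? i t) es))
      ≡⟨ cong₂ _+_ (∑ᵗ-arrangements-∷ D i (layer H e) (layer-multiplicityFree size≡) (length-layer size≡))
                   (∑ᵗ-arranged-edges i es unique uniform) ⟩
    multiplicity i (layer H e) * D ! + layerDegree i es * D !
      ≡⟨ ℕP.*-distribʳ-+ (D !) (multiplicity i (layer H e)) (layerDegree i es) ⟨
    layerDegree i (e ∷ es) * D !
      ∎
    where open ≡-Reasoning

  layerDegree-↑ˡ : ∀ v es → UniformEdges es → layerDegree (v ↑ˡ D) es ≡ length (filter (v ∈?_) es)
  layerDegree-↑ˡ v []       []                = refl
  layerDegree-↑ˡ v (e ∷ es) (size≡ ∷ uniform) = begin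
    multiplicity (v ↑ˡ D) (layer H e) + layerDegree (v ↑ˡ D) es
      ≡⟨ cong₂ _+_ (multiplicity-layer-↑ˡ size≡ v) (layerDegree-↑ˡ v es uniform) ⟩
    𝟙 (v ∈? e) + length (filter (v ∈?_) es)
      ≡⟨ length-filter-∷ (v ∈?_) e es ⟨
    length (filter (v ∈?_) (e ∷ es))
      ∎
    where open ≡-Reasoning

  layerDegree-↑ʳ : ∀ s es → UniformEdges es → layerDegree (n ↑ʳ s) es ≡ 0
  layerDegree-↑ʳ s []       []                = refl
  layerDegree-↑ʳ s (e ∷ es) (size≡ ∷ uniform) =
    cong₂ _+_ (multiplicity-layer-↑ʳ size≡ s) (layerDegree-↑ʳ s es uniform)

  module _ (uniform : UniformEdges (edges H)) where

    layeredAdj-summand : ∀ i t →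
      layeredAdj H (cons i t) ℚ.* prodFin D (vertexIndicator ∘ t)
        ≡ 𝟙 (any? (arranges? i t) (edges H)) · 1/D!
    layeredAdj-summand i t with any? (arranges? i t) (edges H)
    ... | yes arr = begin
      1/D! ℚ.* prodFin D (vertexIndicator ∘ t) ≡⟨ cong (1/D! ℚ.*_) (prodFin-1ℚ D _ entry≡1ℚ) ⟩
      1/D! ℚ.* 1ℚ                              ≡⟨ ℚP.*-identityʳ 1/D! ⟩
      1/D!                                     ≡⟨ ℚP.+-identityʳ 1/D! ⟨
      1 · 1/D!                                 ∎
      where
      open ≡-Reasoning
      entry≡1ℚ : ∀ k → vertexIndicator (t k) ≡ 1ℚ
      entry≡1ℚ k with All.lookupAny uniform arr
      ... | size≡ , arr-e = vertexIndicator-layer size≡ (t k)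
        (subst (0 <_) (arr-e (t k)) (0<multiplicity-tabulate (cons i t) (Fin.suc k)))
    ... | no _    = ℚP.*-zeroˡ (prodFin D (vertexIndicator ∘ t))

    layeredAdj-row : ∀ i →
      sumTuples D N (λ t → layeredAdj H (cons i t) ℚ.* prodFin D (vertexIndicator ∘ t))
        ≡ layerDegree i (edges H) · 1ℚ
    layeredAdj-row i = begin
      sumTuples D N (λ t → layeredAdj H (cons i t) ℚ.* prodFin D (vertexIndicator ∘ t))
        ≡⟨ sumTuples≡∑ᵗ D N _ ⟩
      ℚᵗ.∑ᵗ D N (λ t → layeredAdj H (cons i t) ℚ.* prodFin D (vertexIndicator ∘ t))
        ≡⟨ ℚᵗ.∑ᵗ-cong D N (layeredAdj-summand i) ⟩
      ℚᵗ.∑ᵗ D N (λ t → 𝟙 (any? (arranges? i t) (edges H)) · 1/D!)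
        ≡⟨ ∑ᵗ-· D N (λ t → 𝟙 (any? (arranges? i t) (edges H))) 1/D! ⟩
      ∑ᵗ D N (λ t → 𝟙 (any? (arranges? i t) (edges H))) · 1/D!
        ≡⟨ cong (_· 1/D!) (∑ᵗ-arranged-edges i (edges H) (distinct H) uniform) ⟩
      (layerDegree i (edges H) * D !) · 1/D!
        ≡⟨ ×-assocˡ 1/D! (layerDegree i (edges H)) (D !) ⟨
      layerDegree i (edges H) · ((D !) · 1/D!)
        ≡⟨ cong (layerDegree i (edges H) ·_) (·-inverse (D !) {{D !≢0}}) ⟩
      layerDegree i (edges H) · 1ℚ
        ∎
      where open ≡-Reasoning

    vertexIndicator-eigenpair : ∀ {r} → Regular r H → Fin n →
      IsEigenpair (layeredAdj H) (+ r / 1) vertexIndicator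
    vertexIndicator-eigenpair {r} regular v₀ = (v₀ ↑ˡ D , nonzero) , fin+-elim Row vertex-row extra-row
      where
      open ≡-Reasoning
      Row : Fin N → Set
      Row i = sumTuples D N (λ t → layeredAdj H (cons i t) ℚ.* prodFin D (vertexIndicator ∘ t))
            ≡ (+ r / 1) ℚ.* (vertexIndicator i ^ D)

      nonzero : vertexIndicator (v₀ ↑ˡ D) ≢ 0ℚ
      nonzero eq with trans (sym (vertexIndicator-↑ˡ v₀)) eq
      ... | ()

      vertex-row : ∀ v → Row (v ↑ˡ D)
      vertex-row v = begin
        _                                   ≡⟨ layeredAdj-row (v ↑ˡ D) ⟩
        layerDegree (v ↑ˡ D) (edges H) · 1ℚ ≡⟨ cong (_· 1ℚ) (layerDegree-↑ˡ v (edges H) uniform) ⟩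
        deg H v · 1ℚ                        ≡⟨ cong (_· 1ℚ) (regular v) ⟩
        r · 1ℚ                              ≡⟨ ·1ℚ≡n/1 r ⟩
        + r / 1                             ≡⟨ ℚP.*-identityʳ (+ r / 1) ⟨
        (+ r / 1) ℚ.* 1ℚ                    ≡⟨ cong ((+ r / 1) ℚ.*_) (1ℚ^n≡1ℚ D) ⟨
        (+ r / 1) ℚ.* (1ℚ ^ D)              ≡⟨ cong (λ x → (+ r / 1) ℚ.* (x ^ D)) (vertexIndicator-↑ˡ v) ⟨
        (+ r / 1) ℚ.* (vertexIndicator (v ↑ˡ D) ^ D) ∎

      extra-row : ∀ s → Row (n ↑ʳ s)
      extra-row s = begin
        _                                   ≡⟨ layeredAdj-row (n ↑ʳ s) ⟩
        layerDegree (n ↑ʳ s) (edges H) · 1ℚ ≡⟨ cong (_· 1ℚ) (layerDegree-↑ʳ s (edges H) uniform) ⟩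
        0ℚ                                  ≡⟨ ℚP.*-zeroʳ (+ r / 1) ⟨
        (+ r / 1) ℚ.* 0ℚ                    ≡⟨ cong ((+ r / 1) ℚ.*_) (0ℚ^n≡0ℚ D {{FinP.nonZeroIndex s}}) ⟨
        (+ r / 1) ℚ.* (0ℚ ^ D)              ≡⟨ cong (λ x → (+ r / 1) ℚ.* (x ^ D)) (vertexIndicator-↑ʳ s) ⟨
        (+ r / 1) ℚ.* (vertexIndicator (n ↑ʳ s) ^ D) ∎

-- Extremal degrees

maxList-lub : ∀ {k xs} → All (_≤ k) xs → maxList xs ≤ k
maxList-lub = ListP.foldr-preservesᵇ ℕP.⊔-lub z≤n

maxList-map-≡ : ∀ {a} {A : Set a} {f : A → ℕ} {k} xs → xs ≢ [] → All (λ x → f x ≡ k) xs →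
  maxList (map f xs) ≡ k
maxList-map-≡ []       []≢[] _             = contradiction refl []≢[]
maxList-map-≡ (x ∷ xs) _     (fx≡k ∷ rest) =
  trans (cong (_⊔ _) fx≡k) (ℕP.m≥n⇒m⊔n≡m (maxList-lub (AllP.map⁺ (All.map ℕP.≤-reflexive rest))))

m<n∸1⇒1+m<n : ∀ {m n} → m < n ∸ 1 → suc m < n
m<n∸1⇒1+m<n {n = suc n} m<n = s≤s m<n

edges-nonempty : ∀ {n r} (H : Hypergraph (suc n)) → Regular (suc r) H → edges H ≢ []
edges-nonempty H regular es≡[]
  with trans (sym (regular Fin.zero)) (cong (λ es → length (filter (Fin.zero ∈?_) es)) es≡[])
... | ()

Δ-regular : ∀ {n r} (H : Hypergraph (suc n)) → Regular r H → Δ H ≡ r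
Δ-regular {n} H regular = maxList-map-≡ (allFin (suc n)) (λ ()) (AllP.tabulate⁺ regular)

module _ {n r : ℕ} (H : Hypergraph n) (uniform : Uniform r H) where

  kmax-uniform : edges H ≢ [] → kmax H ≡ r
  kmax-uniform es≢[] = maxList-map-≡ (edges H) es≢[] uniform

  kmax-uniform-≤ : kmax H ≤ r
  kmax-uniform-≤ = maxList-lub (AllP.map⁺ (All.map ℕP.≤-reflexive uniform))

  edgesUpTo-uniform : ∀ {k} → k < r → edgesUpTo H k ≡ 0
  edgesUpTo-uniform {k} k<r = cong length (ListP.filter-none (λ e → size e ℕP.≤? k)
    (All.map (λ size≡r size≤k → ℕP.<⇒≱ k<r (subst (_≤ k) size≡r size≤k)) uniform))

  Δ⋆-uniform : Δ⋆ H ≡ 0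
  Δ⋆-uniform = ℕP.n≤0⇒n≡0 (maxList-lub (AllP.map⁺ (AllP.tabulate⁺ (λ t →
    ℕP.≤-reflexive (edgesUpTo-uniform (ℕP.<-≤-trans (m<n∸1⇒1+m<n (FinP.toℕ<n t)) kmax-uniform-≤))))))

mainTheorem7 : (n r : ℕ) → 1 ≤ n → 2 ≤ r → (H : Hypergraph n) →
    Uniform r H → Regular r H →
    ((Δ H ⊔ Δ⋆ H) ≡ r) × IsEigenvalue (layeredAdj H) (+ r / 1)
mainTheorem7 (suc n) (suc r) (s≤s _) (s≤s _) H uniform regular = degrees , vertexIndicator , eigenpair
  where
  open UniformLayers H
  degrees : Δ H ⊔ Δ⋆ H ≡ suc r
  degrees = trans (cong₂ _⊔_ (Δ-regular H regular) (Δ⋆-uniform H uniform)) (ℕP.⊔-identityʳ (suc r))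
  kmax≡r : kmax H ≡ suc r
  kmax≡r = kmax-uniform H uniform (edges-nonempty H regular)
  eigenpair : IsEigenpair (layeredAdj H) (+ suc r / 1) vertexIndicator
  eigenpair = vertexIndicator-eigenpair (subst (λ k → Uniform (suc (k ∸ 1)) H) (sym kmax≡r) uniform)
                                        regular Fin.zero
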